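{- Let $\varphi\in\mathcal{L}_{pqT}$ and let $\pi$ be a lex model. If $\varphi$ is fully strict, then $\pi\models\varphi$ if and only if $\pi\models\varphi^{(\ge)}$ and $R_\varphi\cap S_\varphi\cap V_\pi\neq\emptyset$. If $\varphi$ is weakly strict, then $\pi\models\varphi$ if and only if $\pi\models\varphi^{(\ge)}$ and $(R_\varphi\cup S_\varphi)\cap V_\pi\neq\emptyset$.
   Context: Let $V$ be a finite set of variables with finite nonempty domains $\underline{X}$; $\underline{A}=\prod_{X\in A}\underline{X}$; outcomes are elements of $\underline{V}$; $\alpha(U)$ is restriction. A lex model $\pi$ is a (possibly empty) sequence $(Y_1,\ge_{Y_1}),\ldots,(Y_k,\ge_{Y_k})$ of pairwise distinct variables each with a total order on its domain; $V_\pi=\{Y_1,\dots,Y_k\}$. $\alpha\succ_\pi\beta$ iff for some $i$, $\alpha(Y_j)=\beta(Y_j)$ for $j<i$ and $\alpha(Y_i)>_{Y_i}\beta(Y_i)$ strictly; $\alpha\equiv_\pi\beta$ iff $\alpha(V_\pi)=\beta(V_\pi)$; $\alpha\succcurlyeq_\pi\beta$ iff $\alpha\succ_\pi\beta$ or $\alpha\equiv_\pi\beta$. A statement $\varphi$ of $\mathcal{L}_{pqT}$ consists of $\rhd\in\{\ge,\gg,>\}$, pairwise disjoint sets $U_\varphi,T_\varphi,R_\varphi\cup S_\varphi\subseteq V$, assignments $u_\varphi\in\underline{U_\varphi}$, $r_\varphi\in\underline{R_\varphi}$, $s_\varphi\in\underline{S_\varphi}$ with $r_\varphi(Y)\ne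 s_\varphi(Y)$ for $Y\in R_\varphi\cap S_\varphi$, every variable with a one-element domain lying in $T_\varphi$; written $u_\varphi r_\varphi\rhd u_\varphi s_\varphi\parallel T_\varphi$. $\varphi^*$ is the set of pairs $(\alpha,\beta)$ of outcomes with $\alpha$ extending $u_\varphi,r_\varphi$, $\beta$ extending $u_\varphi,s_\varphi$, and $\alpha(T_\varphi)=\beta(T_\varphi)$. $\varphi$ is non-strict if $\rhd$ is $\ge$, fully strict if $\gg$, weakly strict if $>$; $\varphi^{(\ge)}$ is the non-strict statement with the same data. Non-strict: $\pi\models\varphi$ iff $\alpha\succcurlyeq_\pi\beta$ for all $(\alpha,\beta)\in\varphi^*$; fully strict: iff $\alpha\succ_\pi\beta$ for all $(\alpha,\beta)\in\varphi^*$; weakly strict: iff $\pi\models\varphi^{(\ge)}$ and $\alpha\succ_\pi\beta$ for some $(\alpha,\beta)\in\varphi^*$. -}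

module Defs where

open import Level using (0ℓ)
open import Data.Nat using (ℕ; _<_)
open import Data.Fin using (Fin)
open import Data.Fin.Subset using (Subset; _∈_)
open import Data.Product using (Σ; ∃; _×_; _,_; proj₁)
open import Data.Sum using (_⊎_)
open import Data.Empty using (⊥)
open import Data.List using (List; []; _∷_; map)
open import Data.List.Relation.Unary.All using (All)
open import Data.List.Relation.Unary.Unique.Propositional using (Unique)
import Data.List.Membership.Propositional as LM
open import Relation.Binary using (Rel; IsTotalOrder)
open import Relation.Binary.PropositionalEquality using (_≡_; _≢_)

Outcome : (n : ℕ) → (Fin n → ℕ) → Set
Outcome n d = (i : Fin n) → Fin (d i)

record DomOrder (m : ℕ) : Set₁ where
  field
    _≥ₒ_ : Rel (Fin m) 0ℓ
    isTotalOrder : IsTotalOrder _≡_ _≥ₒ_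

_>[_]_ : ∀ {m} → Fin m → DomOrder m → Fin m → Set
a >[ o ] b = DomOrder._≥ₒ_ o a b × a ≢ b

module _ {n : ℕ} {d : Fin n → ℕ} where

  Entry : Set₁
  Entry = Σ (Fin n) (λ Y → DomOrder (d Y))

  record LexModel : Set₁ where
    constructor lexModel
    field
      entries  : List Entry
      distinct : Unique (map proj₁ entries)

  vars : LexModel → List (Fin n)
  vars π = map proj₁ (LexModel.entries π)

  Better : List Entry → Outcome n d → Outcome n d → Set
  Better [] α β = ⊥
  Better ((Y , o) ∷ es) α β = (α Y >[ o ] β Y) ⊎ (α Y ≡ β Y × Better es α β)

  _≻[_]_ : Outcome n d → LexModel → Outcome n d → Set
  α ≻[ π ] β = Better (LexModel.entries π) α β

  _≡[_]_ : Outcome n d → LexModel → Outcome n d → Set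
  α ≡[ π ] β = All (λ Y → α Y ≡ β Y) (vars π)

  _≽[_]_ : Outcome n d → LexModel → Outcome n d → Set
  α ≽[ π ] β = (α ≻[ π ] β) ⊎ (α ≡[ π ] β)

  data Kind : Set where
    nonStrict fullyStrict weaklyStrict : Kind

  Assign : Subset n → Set
  Assign A = (i : Fin n) → i ∈ A → Fin (d i)

  -- a statement of L_pqT :  u r ▷ u s ∥ T
  record PqT : Set where
    field
      kind : Kind
      U T R S : Subset n
      u : Assign U
      r : Assign R
      s : Assign S
      disjUT  : ∀ i → i ∈ U → i ∈ T → ⊥
      disjUR  : ∀ i → i ∈ U → i ∈ R → ⊥
      disjUS  : ∀ i → i ∈ U → i ∈ S → ⊥
      disjTR  : ∀ i → i ∈ T → i ∈ R → ⊥
      disjTS  : ∀ i → i ∈ T → i ∈ S → ⊥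
      rsDiff  : ∀ i (p : i ∈ R) (q : i ∈ S) → r i p ≢ s i q
      singleT : ∀ i → d i ≡ 1 → i ∈ T

  open PqT

  nonStrictVersion : PqT → PqT
  nonStrictVersion φ = record φ { kind = nonStrict }

  InStar : PqT → Outcome n d → Outcome n d → Set
  InStar φ α β =
    (∀ i (p : i ∈ U φ) → α i ≡ u φ i p) ×
    (∀ i (p : i ∈ U φ) → β i ≡ u φ i p) ×
    (∀ i (p : i ∈ R φ) → α i ≡ r φ i p) ×
    (∀ i (p : i ∈ S φ) → β i ≡ s φ i p) ×
    (∀ i → i ∈ T φ → α i ≡ β i)

  SatNS : LexModel → PqT → Set
  SatNS π φ = ∀ α β → InStar φ α β → α ≽[ π ] β

  _⊨_ : LexModel → PqT → Set
  π ⊨ φ with kind φ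
  ... | nonStrict    = SatNS π φ
  ... | fullyStrict  = ∀ α β → InStar φ α β → α ≻[ π ] β
  ... | weaklyStrict = SatNS π φ × ∃ (λ α → ∃ (λ β → InStar φ α β × α ≻[ π ] β))

  _∈V_ : Fin n → LexModel → Set
  Y ∈V π = Y LM.∈ vars π

{-# OPTIONS --safe #-}
-- A pair of φ* cannot tie under π at a variable of R ∩ S, where r and s differ; at a
-- variable of R ∖ S (or S ∖ R) a tie can be broken by moving the unconstrained side, whose
-- domain has two values because the variable is not in T. Conversely, overriding any outcome
-- by u, r, s yields a pair of φ* differing only on R ∩ S, so if every pair is strictly
-- improved, R ∩ S meets V_π. If some pair (α, β) is strictly improved, the decisive variable
-- Z lies in R ∪ S: otherwise swapping α Z and β Z gives a pair of φ* ranked the other way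
-- round, contradicting π ⊨ φ^(≥).
module Submission where

open import Defs
open import Data.Nat using (ℕ; _<_; zero; suc)
open import Data.Fin using (Fin; zero; suc; fromℕ<)
open import Data.Fin.Properties using (_≟_)
open import Data.Fin.Subset using (Subset; _∈_; _∉_)
open import Data.Fin.Subset.Properties using (_∈?_)
open import Data.Vec.Properties.WithK using ([]=-irrelevant)
open import Data.Product using (∃; ∃-syntax; _×_; _,_; proj₁)
open import Data.Sum using (_⊎_; inj₁; inj₂)
open import Data.List using ([]; _∷_; _++_; map)
open import Data.List.Relation.Unary.All using (All; []; _∷_)
import Data.List.Relation.Unary.All as All
open import Data.List.Relation.Unary.Any using (here; there)
open import Data.List.Membership.Propositional using () renaming (_∈_ to _∈ₗ_)
open import Data.List.Membership.Propositional.Properties using (∈-map⁺; ∈-++⁺ʳ)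
open import Relation.Nullary using (¬_; Dec; yes; no; contradiction)
open import Relation.Binary using (IsTotalOrder)
open import Function.Bundles using (_⇔_; mk⇔)
open import Relation.Binary.PropositionalEquality
  using (_≡_; _≢_; refl; sym; trans; cong; subst₂)

∃≢ : ∀ {m} → m ≢ 1 → (x : Fin m) → ∃[ y ] y ≢ x
∃≢ {suc zero}    m≢1 _       = contradiction refl m≢1
∃≢ {suc (suc _)} _   zero    = suc zero , λ ()
∃≢ {suc (suc _)} _   (suc _) = zero , λ ()

module _ {n : ℕ} {d : Fin n → ℕ} where

  Better⇒≢ : ∀ {es α β} → Better {n} {d} es α β → ∃[ Y ] Y ∈ₗ map proj₁ es × α Y ≢ β Y
  Better⇒≢ {(Y , _) ∷ _} (inj₁ (_ , α≢β)) = Y , here refl , α≢β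
  Better⇒≢ {_ ∷ _}       (inj₂ (_ , α≻β)) with Better⇒≢ α≻β
  ... | Y , Y∈ , α≢β = Y , there Y∈ , α≢β

  Better-asym : ∀ {es α β} → Better {n} {d} es α β → ¬ Better es β α
  Better-asym {(_ , o) ∷ _} (inj₁ (α≥β , α≢β)) (inj₁ (β≥α , _)) =
    α≢β (IsTotalOrder.antisym (DomOrder.isTotalOrder o) α≥β β≥α)
  Better-asym {_ ∷ _} (inj₁ (_ , α≢β)) (inj₂ (β≡α , _)) = α≢β (sym β≡α)
  Better-asym {_ ∷ _} (inj₂ (α≡β , _)) (inj₁ (_ , β≢α)) = β≢α (sym α≡β)
  Better-asym {_ ∷ _} (inj₂ (_ , α≻β)) (inj₂ (_ , β≻α)) = Better-asym α≻β β≻α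

  Better-split : ∀ {es α β} → Better {n} {d} es α β →
    ∃[ pre ] ∃[ Z ] ∃[ o ] ∃[ post ] es ≡ pre ++ (Z , o) ∷ post ×
      All (λ Y → α Y ≡ β Y) (map proj₁ pre) × α Z >[ o ] β Z
  Better-split {(Z , o) ∷ post} (inj₁ α>β) = [] , Z , o , post , refl , [] , α>β
  Better-split {e ∷ _} (inj₂ (α≡β , α≻β)) with Better-split α≻β
  ... | pre , Z , o , post , refl , agree , α>β =
    e ∷ pre , Z , o , post , refl , α≡β ∷ agree , α>β

  Better-join : ∀ pre {Z o post α β} → All (λ Y → α Y ≡ β Y) (map proj₁ pre) →
    α Z >[ o ] β Z → Better {n} {d} (pre ++ (Z , o) ∷ post) α β
  Better-join []        []             α>β = inj₁ α>β
  Better-join (_ ∷ pre) (α≡β ∷ agree) α>β = inj₂ (α≡β , Better-join pre agree α>β)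

  ≻⇒¬≼ : ∀ {π : LexModel {n} {d}} {α β} → β ≻[ π ] α → ¬ (α ≽[ π ] β)
  ≻⇒¬≼ β≻α (inj₁ α≻β) = Better-asym α≻β β≻α
  ≻⇒¬≼ β≻α (inj₂ α≡β) with Better⇒≢ β≻α
  ... | _ , Y∈ , β≢α = β≢α (sym (All.lookup α≡β Y∈))

  ≽∧≢⇒≻ : ∀ {π : LexModel {n} {d}} {α β Y} →
    α ≽[ π ] β → Y ∈V π → α Y ≢ β Y → α ≻[ π ] β
  ≽∧≢⇒≻ (inj₁ α≻β) _   _   = α≻β
  ≽∧≢⇒≻ (inj₂ α≡β) Y∈ α≢β = contradiction (All.lookup α≡β Y∈) α≢β

  _[_≔_] : Outcome n d → (Y : Fin n) → Fin (d Y) → Outcome n d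
  (α [ Y ≔ v ]) i with i ≟ Y
  ... | yes refl = v
  ... | no _     = α i

  update-≡ : ∀ α Y v → (α [ Y ≔ v ]) Y ≡ v
  update-≡ α Y v with Y ≟ Y
  ... | yes refl = refl
  ... | no Y≢Y   = contradiction refl Y≢Y

  update-≢ : ∀ α {Y} v {i} → i ≢ Y → (α [ Y ≔ v ]) i ≡ α i
  update-≢ α {Y} v {i} i≢Y with i ≟ Y
  ... | yes i≡Y = contradiction i≡Y i≢Y
  ... | no _    = refl

  ∈∧∉⇒≢ : ∀ {A : Subset n} {i Y} → i ∈ A → Y ∉ A → i ≢ Y
  ∈∧∉⇒≢ i∈A Y∉A refl = Y∉A i∈A

  Better-swap : ∀ pre {Z o post α β} → All (λ Y → α Y ≡ β Y) (map proj₁ pre) →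
    α Z >[ o ] β Z → Better (pre ++ (Z , o) ∷ post) (β [ Z ≔ α Z ]) (α [ Z ≔ β Z ])
  Better-swap pre {Z} {o} {α = α} {β} agree (α≥β , α≢β) =
    Better-join pre (All.map agree′ agree)
      ( subst₂ (DomOrder._≥ₒ_ o) (sym (update-≡ β Z (α Z))) (sym (update-≡ α Z (β Z))) α≥β
      , λ eq → α≢β (trans (sym (update-≡ β Z (α Z))) (trans eq (update-≡ α Z (β Z)))) )
    where
    agree′ : ∀ {Y} → α Y ≡ β Y → (β [ Z ≔ α Z ]) Y ≡ (α [ Z ≔ β Z ]) Y
    agree′ {Y} αY≡βY = trans (update-≢ β (α Z) Y≢Z)
                         (trans (sym αY≡βY) (sym (update-≢ α (β Z) Y≢Z)))
      where
      Y≢Z : Y ≢ Z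
      Y≢Z refl = α≢β αY≡βY

  override : ∀ {A} → Assign {n} {d} A → Outcome n d → Outcome n d
  override {A} a γ i with i ∈? A
  ... | yes i∈A = a i i∈A
  ... | no _    = γ i

  override-∈ : ∀ {A} (a : Assign {n} {d} A) γ {i} (i∈A : i ∈ A) →
    override a γ i ≡ a i i∈A
  override-∈ {A} a γ {i} i∈A with i ∈? A
  ... | yes i∈A′ = cong (a i) ([]=-irrelevant i∈A′ i∈A)
  ... | no i∉A   = contradiction i∈A i∉A

  override-∉ : ∀ {A} (a : Assign {n} {d} A) γ {i} → i ∉ A → override a γ i ≡ γ i
  override-∉ {A} a γ {i} i∉A with i ∈? A
  ... | yes i∈A = contradiction i∈A i∉A
  ... | no _    = refl

  module _ (φ : PqT {n} {d}) where
    open PqT φ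

    InStar-updateˡ : ∀ {α β Y} v → Y ∉ U → Y ∉ R → Y ∉ T →
      InStar φ α β → InStar φ (α [ Y ≔ v ]) β
    InStar-updateˡ {α} v Y∉U Y∉R Y∉T (αU , βU , αR , βS , αβT) =
      (λ i p → trans (update-≢ α v (∈∧∉⇒≢ p Y∉U)) (αU i p)) , βU ,
      (λ i p → trans (update-≢ α v (∈∧∉⇒≢ p Y∉R)) (αR i p)) , βS ,
      (λ i p → trans (update-≢ α v (∈∧∉⇒≢ p Y∉T)) (αβT i p))

    InStar-updateʳ : ∀ {α β Y} v → Y ∉ U → Y ∉ S → Y ∉ T →
      InStar φ α β → InStar φ α (β [ Y ≔ v ])
    InStar-updateʳ {β = β} v Y∉U Y∉S Y∉T (αU , βU , αR , βS , αβT) =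
      αU , (λ i p → trans (update-≢ β v (∈∧∉⇒≢ p Y∉U)) (βU i p)) ,
      αR , (λ i p → trans (update-≢ β v (∈∧∉⇒≢ p Y∉S)) (βS i p)) ,
      (λ i p → trans (αβT i p) (sym (update-≢ β v (∈∧∉⇒≢ p Y∉T))))

    InStar-≢⇒∉U : ∀ {α β Y} → InStar φ α β → α Y ≢ β Y → Y ∉ U
    InStar-≢⇒∉U (αU , βU , _) α≢β Y∈U = α≢β (trans (αU _ Y∈U) (sym (βU _ Y∈U)))

    InStar-≢⇒∉T : ∀ {α β Y} → InStar φ α β → α Y ≢ β Y → Y ∉ T
    InStar-≢⇒∉T (_ , _ , _ , _ , αβT) α≢β Y∈T = α≢β (αβT _ Y∈T)

    InStar-R∩S⇒≢ : ∀ {α β Y} → InStar φ α β → Y ∈ R → Y ∈ S → α Y ≢ β Y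
    InStar-R∩S⇒≢ (_ , _ , αR , βS , _) Y∈R Y∈S α≡β =
      rsDiff _ Y∈R Y∈S (trans (sym (αR _ Y∈R)) (trans α≡β (βS _ Y∈S)))

    canonicalˡ canonicalʳ : Outcome n d → Outcome n d
    canonicalˡ γ = override u (override r (override s γ))
    canonicalʳ γ = override s (canonicalˡ γ)

    InStar-canonical : ∀ γ → InStar φ (canonicalˡ γ) (canonicalʳ γ)
    InStar-canonical γ =
      (λ i i∈U → override-∈ u _ i∈U) ,
      (λ i i∈U → trans (override-∉ s _ (λ i∈S → disjUS i i∈U i∈S)) (override-∈ u _ i∈U)) ,
      (λ i i∈R → trans (override-∉ u _ (λ i∈U → disjUR i i∈U i∈R)) (override-∈ r _ i∈R)) ,
      (λ i i∈S → override-∈ s _ i∈S) ,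
      (λ i i∈T → sym (override-∉ s _ (disjTS i i∈T)))

    canonical-≢⇒R∩S : ∀ γ {Y} → canonicalˡ γ Y ≢ canonicalʳ γ Y → Y ∈ R × Y ∈ S
    canonical-≢⇒R∩S γ {Y} ˡ≢ʳ = decide (Y ∈? R) (Y ∈? S)
      where
      decide : Dec (Y ∈ R) → Dec (Y ∈ S) → Y ∈ R × Y ∈ S
      decide (yes Y∈R) (yes Y∈S) = Y∈R , Y∈S
      decide _         (no Y∉S)  = contradiction (sym (override-∉ s (canonicalˡ γ) Y∉S)) ˡ≢ʳ
      decide (no Y∉R)  (yes Y∈S) = contradiction
        (trans (override-∉ u _ (λ Y∈U → disjUS Y Y∈U Y∈S))
          (trans (override-∉ r _ Y∉R)
            (trans (override-∈ s γ Y∈S) (sym (override-∈ s (canonicalˡ γ) Y∈S)))))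
        ˡ≢ʳ

    ∉T⇒≢1 : ∀ {Y} → Y ∉ T → d Y ≢ 1
    ∉T⇒≢1 Y∉T dY≡1 = Y∉T (singleT _ dY≡1)

    InStar-separateˡ : ∀ {α β Y} → InStar φ α β → Y ∉ U → Y ∉ R → Y ∉ T →
      ∃[ α′ ] InStar φ α′ β × α′ Y ≢ β Y
    InStar-separateˡ {α} {β} {Y} st Y∉U Y∉R Y∉T with ∃≢ (∉T⇒≢1 Y∉T) (β Y)
    ... | w , w≢β = α [ Y ≔ w ] , InStar-updateˡ w Y∉U Y∉R Y∉T st ,
                    λ eq → w≢β (trans (sym (update-≡ α Y w)) eq)

    InStar-separateʳ : ∀ {α β Y} → InStar φ α β → Y ∉ U → Y ∉ S → Y ∉ T →
      ∃[ β′ ] InStar φ α β′ × α Y ≢ β′ Y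
    InStar-separateʳ {α} {β} {Y} st Y∉U Y∉S Y∉T with ∃≢ (∉T⇒≢1 Y∉T) (α Y)
    ... | w , w≢α = β [ Y ≔ w ] , InStar-updateʳ w Y∉U Y∉S Y∉T st ,
                    λ eq → w≢α (sym (trans eq (update-≡ β Y w)))

    InStar-separating : Outcome n d → ∀ {Y} → Y ∈ R ⊎ Y ∈ S →
      ∃[ α ] ∃[ β ] InStar φ α β × α Y ≢ β Y
    InStar-separating γ {Y} Y∈R∪S with Y ∈? R | Y ∈? S | Y∈R∪S
    ... | yes Y∈R | yes Y∈S | _ = _ , _ , st , InStar-R∩S⇒≢ st Y∈R Y∈S
      where st = InStar-canonical γ
    ... | yes Y∈R | no Y∉S | _
      with InStar-separateʳ (InStar-canonical γ)
             (λ Y∈U → disjUR Y Y∈U Y∈R) Y∉S (λ Y∈T → disjTR Y Y∈T Y∈R)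
    ...   | β , st , α≢β = _ , β , st , α≢β
    InStar-separating γ _ | no Y∉R | yes Y∈S | _
      with InStar-separateˡ (InStar-canonical γ)
             (λ Y∈U → disjUS _ Y∈U Y∈S) Y∉R (λ Y∈T → disjTS _ Y∈T Y∈S)
    ...   | α , st , α≢β = α , _ , st , α≢β
    InStar-separating γ _ | no Y∉R | no Y∉S | inj₁ Y∈R = contradiction Y∈R Y∉R
    InStar-separating γ _ | no Y∉R | no Y∉S | inj₂ Y∈S = contradiction Y∈S Y∉S

    decisive-∈R∪S : ∀ pre {Z o post uniq α β} →
      SatNS (lexModel (pre ++ (Z , o) ∷ post) uniq) φ → InStar φ α β →
      All (λ Y → α Y ≡ β Y) (map proj₁ pre) → α Z >[ o ] β Z → Z ∈ R ⊎ Z ∈ S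
    decisive-∈R∪S pre {Z} {uniq = uniq} {α} {β} sat st agree α>β@(_ , α≢β)
      with Z ∈? R | Z ∈? S
    ... | yes Z∈R | _       = inj₁ Z∈R
    ... | no _    | yes Z∈S = inj₂ Z∈S
    ... | no Z∉R  | no Z∉S  =
      contradiction (sat _ _ swapped)
        (≻⇒¬≼ {π = lexModel _ uniq} (Better-swap pre agree α>β))
      where
      Z∉U = InStar-≢⇒∉U st α≢β
      Z∉T = InStar-≢⇒∉T st α≢β
      swapped : InStar φ (α [ Z ≔ β Z ]) (β [ Z ≔ α Z ])
      swapped = InStar-updateʳ (α Z) Z∉U Z∉S Z∉T (InStar-updateˡ (β Z) Z∉U Z∉R Z∉T st)

    SatNS∧≻⇒R∪S : ∀ {π : LexModel {n} {d}} {α β} →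
      SatNS π φ → InStar φ α β → α ≻[ π ] β → ∃[ Y ] (Y ∈ R ⊎ Y ∈ S) × Y ∈V π
    SatNS∧≻⇒R∪S {lexModel _ uniq} sat st α≻β with Better-split α≻β
    ... | pre , Z , o , post , refl , agree , α>β =
      Z , decisive-∈R∪S pre {uniq = uniq} sat st agree α>β ,
      ∈-map⁺ proj₁ (∈-++⁺ʳ pre (here refl))

    SatNS∧R∪S⇒∃≻ : Outcome n d → ∀ {π : LexModel {n} {d}} {Y} →
      SatNS π φ → Y ∈ R ⊎ Y ∈ S → Y ∈V π → ∃[ α ] ∃[ β ] InStar φ α β × α ≻[ π ] β
    SatNS∧R∪S⇒∃≻ γ {π} sat Y∈R∪S Y∈π with InStar-separating γ Y∈R∪S
    ... | α , β , st , α≢β = α , β , st , ≽∧≢⇒≻ {π = π} (sat α β st) Y∈π α≢β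

    ∀≻⇒R∩S : Outcome n d → ∀ {π : LexModel {n} {d}} →
      (∀ α β → InStar φ α β → α ≻[ π ] β) → ∃[ Y ] (Y ∈ R × Y ∈ S) × Y ∈V π
    ∀≻⇒R∩S γ all≻ with Better⇒≢ (all≻ _ _ (InStar-canonical γ))
    ... | Y , Y∈π , ˡ≢ʳ = Y , canonical-≢⇒R∩S γ ˡ≢ʳ , Y∈π

    SatNS∧R∩S⇒∀≻ : ∀ {π : LexModel {n} {d}} {Y} →
      SatNS π φ → Y ∈ R → Y ∈ S → Y ∈V π → ∀ α β → InStar φ α β → α ≻[ π ] β
    SatNS∧R∩S⇒∀≻ {π} sat Y∈R Y∈S Y∈π α β st =
      ≽∧≢⇒≻ {π = π} (sat α β st) Y∈π (InStar-R∩S⇒≢ st Y∈R Y∈S)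

    fullyStrict-⇔ : Outcome n d → (π : LexModel {n} {d}) → kind ≡ fullyStrict →
      (π ⊨ φ) ⇔ ((π ⊨ nonStrictVersion φ) × ∃[ Y ] (Y ∈ R × Y ∈ S) × Y ∈V π)
    fullyStrict-⇔ γ π k rewrite k = mk⇔
      (λ all≻ → (λ α β st → inj₁ (all≻ α β st)) , ∀≻⇒R∩S γ {π} all≻)
      (λ (sat , _ , (Y∈R , Y∈S) , Y∈π) → SatNS∧R∩S⇒∀≻ {π} sat Y∈R Y∈S Y∈π)

    weaklyStrict-⇔ : Outcome n d → (π : LexModel {n} {d}) → kind ≡ weaklyStrict →
      (π ⊨ φ) ⇔ ((π ⊨ nonStrictVersion φ) × ∃[ Y ] (Y ∈ R ⊎ Y ∈ S) × Y ∈V π)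
    weaklyStrict-⇔ γ π k rewrite k = mk⇔
      (λ (sat , _ , _ , st , α≻β) → sat , SatNS∧≻⇒R∪S {π} sat st α≻β)
      (λ (sat , _ , Y∈R∪S , Y∈π) → sat , SatNS∧R∪S⇒∃≻ γ {π} sat Y∈R∪S Y∈π)

proposition13 : (n : ℕ) (d : Fin n → ℕ) → (∀ i → 0 < d i) →
    (φ : PqT {n} {d}) (π : LexModel {n} {d}) →
    (PqT.kind φ ≡ fullyStrict →
      ((π ⊨ φ) ⇔ ((π ⊨ nonStrictVersion φ) ×
        ∃ (λ Y → (Y ∈ PqT.R φ × Y ∈ PqT.S φ) × Y ∈V π)))) ×
    (PqT.kind φ ≡ weaklyStrict →
      ((π ⊨ φ) ⇔ ((π ⊨ nonStrictVersion φ) ×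
        ∃ (λ Y → (Y ∈ PqT.R φ ⊎ Y ∈ PqT.S φ) × Y ∈V π))))
proposition13 n d pos φ π = fullyStrict-⇔ φ γ π , weaklyStrict-⇔ φ γ π
  where
  γ : Outcome n d
  γ i = fromℕ< (pos i)
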